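{- Let $F_1,F_2$ be forests on the node set $[n]$ and let $M$ be any matching in the migrations graph $MG(F_1,F_2)$. Then $|M|\le \tilde d(F_1,F_2)$.
   Context: Nodes are labelled by distinct labels from $[n]$ and identified with them; $p_F(u)$ is the parent of $u$ in $F$, $\bot$ if $u$ is a root. Let $a[i]=p_{F_1}(i)$ if this is not $\bot$ and $a[i]=0$ otherwise; $b[i]$ likewise for $F_2$. The migrations graph $MG(F_1,F_2)$ is the graph on $[n]$ with edge set $\{(i,j) : a[i],a[j],b[i],b[j]\neq0,\ a[i]=a[j],\ b[i]\neq b[j]\}$. Operations on forests: (cut) for $v$ a child of $u$, $(v\dagger u)$ removes edge $(v,u)$; (permutation) apply a permutation $\pi$ of $[n]$, so $\pi(u)$ becomes a child of $\pi(v)$ whenever $u$ was a child of $v$. The size of a sequence is the number of cuts plus the sum over permutations $\pi$ of $|\{x:\pi(x)\neq x\}|$. Write $F\sim F'$ if for every $u$: $p_F(u)=p_{F'}(u)$ or $p_F(u)=\bot$ or $p_{F'}(u)=\bot$. $\tilde d(F_1,F_2)$ is the minimum size of a sequence of cut and permutation operations transforming $F_1$ into some $F_1'$ with $F_1'\sim F_2$. -}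

module Defs where

open import Data.Nat using (ℕ; zero; suc; _+_)
open import Data.Fin using (Fin; _≟_)
open import Data.Fin.Permutation using (Permutation′; _⟨$⟩ʳ_; _⟨$⟩ˡ_)
open import Data.Maybe using (Maybe; just; nothing; _>>=_; Is-just)
import Data.Maybe as Maybe
open import Data.List using (List; []; _∷_; length; filter; allFin; concatMap)
open import Data.List.Relation.Unary.All using (All)
open import Data.List.Relation.Unary.Unique.Propositional using (Unique)
open import Data.Product using (_×_; _,_; Σ)
open import Data.Sum using (_⊎_)
open import Relation.Nullary using (¬_; ¬?)
open import Relation.Binary.PropositionalEquality using (_≡_; _≢_)

-- A parent function on the node set [n] (= Fin n): nothing plays the role of ⊥.
Parent : ℕ → Set
Parent n = Fin n → Maybe (Fin n)

anc : ∀ {n} → Parent n → ℕ → Fin n → Maybe (Fin n)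
anc p zero    u = just u
anc p (suc k) u = anc p k u >>= p

-- A forest: the parent relation is acyclic, i.e. from every node, following
-- parent pointers n times leaves the forest (reaches ⊥).
Forest : ∀ {n} → Parent n → Set
Forest {n} p = ∀ u → anc p n u ≡ nothing

MGEdge : ∀ {n} → Parent n → Parent n → Fin n → Fin n → Set
MGEdge F₁ F₂ i j =
  Is-just (F₁ i) × Is-just (F₁ j) × Is-just (F₂ i) × Is-just (F₂ j)
  × F₁ i ≡ F₁ j × F₂ i ≢ F₂ j

endpoints : ∀ {n} → List (Fin n × Fin n) → List (Fin n)
endpoints = concatMap (λ e → Data.Product.proj₁ e ∷ Data.Product.proj₂ e ∷ [])

-- A matching: a list of MG-edges whose endpoints are pairwise distinct
-- (so edges are pairwise vertex-disjoint and distinct); |M| = length M.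
IsMatching : ∀ {n} → Parent n → Parent n → List (Fin n × Fin n) → Set
IsMatching F₁ F₂ M =
  All (λ e → MGEdge F₁ F₂ (Data.Product.proj₁ e) (Data.Product.proj₂ e)) M
  × Unique (endpoints M)

cutOp : ∀ {n} → Parent n → Fin n → Parent n
cutOp p v x with x ≟ v
... | Relation.Nullary.yes _ = nothing
... | Relation.Nullary.no  _ = p x

-- Permutation: π(u) becomes a child of π(v) whenever u was a child of v.
permOp : ∀ {n} → Permutation′ n → Parent n → Parent n
permOp π p x = Maybe.map (π ⟨$⟩ʳ_) (p (π ⟨$⟩ˡ x))

moved : ∀ {n} → Permutation′ n → ℕ
moved {n} π = length (filter (λ x → ¬? ((π ⟨$⟩ʳ x) ≟ x)) (allFin n))

data Seq {n} : Parent n → Parent n → ℕ → Set where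
  done : ∀ {F} → Seq F F 0
  cut  : ∀ {F G k} (v u : Fin n) → F v ≡ just u →
         Seq (cutOp F v) G k → Seq F G (suc k)
  perm : ∀ {F G k} (π : Permutation′ n) →
         Seq (permOp π F) G k → Seq F G (moved π + k)

_∼_ : ∀ {n} → Parent n → Parent n → Set
F ∼ F' = ∀ u → F u ≡ F' u ⊎ F u ≡ nothing ⊎ F' u ≡ nothing

-- Call an edge (i,j) a migration for (F, F₂) if i and j are siblings in F
-- (same defined parent) but have distinct defined parents in F₂.  We show, by induction on a sequence
-- of operations F ⇝ G of size k with G ∼ F₂, that any vertex-disjoint list of
-- migrations for (F, F₂) has at most k edges:
--   * empty sequence: G ∼ F₂ forces siblings in G that have parents in F₂ to
--     have the same parent there, so no migration exists;
--   * a cut (v † u) or a permutation π only affects the edges with an endpoint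
--     it touches (v, resp. a point moved by π); the other edges stay migrations
--     for the new forest, and by disjointness the touched edges have pairwise
--     distinct touched endpoints, so there are at most 1, resp. moved π, of them.
module Submission where

open import Defs
open import Data.Nat using (ℕ; suc; _≤_; _+_; z≤n; s≤s)
open import Data.Nat.Properties using (≤-trans; ≤-refl; ≤-reflexive; +-suc; +-mono-≤; module ≤-Reasoning)
open import Data.Fin using (Fin; _≟_)
open import Data.Fin.Permutation using (Permutation′; _⟨$⟩ʳ_; _⟨$⟩ˡ_; inverseˡ)
open import Data.Product using (_×_; _,_; proj₁; proj₂)
open import Data.Sum using (inj₁; inj₂)
open import Data.List using (List; []; _∷_; [_]; length; _++_)
open import Data.List.Properties using (length-++-sucʳ)
open import Data.List.Relation.Unary.All using (All; []; _∷_)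
import Data.List.Relation.Unary.All as All
open import Data.List.Relation.Unary.Any using (here; there)
open import Data.List.Relation.Unary.AllPairs using ([]; _∷_)
open import Data.List.Relation.Unary.Unique.Propositional using (Unique)
open import Data.List.Membership.Propositional using (_∈_)
open import Data.List.Membership.Propositional.Properties using (∈-∃++; ∈-++⁻; ∈-++⁺ˡ; ∈-++⁺ʳ; ∈-filter⁺; ∈-allFin)
open import Data.List.Relation.Binary.Subset.Propositional using (_⊆_)
open import Data.List.Relation.Binary.Sublist.Propositional using ([]; _∷ʳ_; _∷_) renaming (_⊆_ to _⊑_)
open import Data.List.Relation.Binary.Sublist.Propositional.Properties using (All-resp-⊆)
open import Data.Maybe using (Maybe; nothing; Is-just)
import Data.Maybe as Maybe
import Data.Maybe.Relation.Unary.Any as MaybeAny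
open import Data.Empty using (⊥-elim)
open import Relation.Nullary using (¬_; ¬?; yes; no)
open import Relation.Nullary.Decidable using (decidable-stable)
open import Relation.Unary using (Pred; Decidable; ∁)
open import Relation.Binary.PropositionalEquality using (_≡_; _≢_; refl; sym; trans; cong; subst)

-- A list without repetitions that is included (as a set) in ys is no longer
-- than ys: remove its head from ys and recurse.
unique-⊆-length : ∀ {A : Set} {xs ys : List A} → Unique xs → xs ⊆ ys → length xs ≤ length ys
unique-⊆-length {xs = []} _ _ = z≤n
unique-⊆-length {xs = x ∷ xs} (x∉xs ∷ u) xs⊆ys with ∈-∃++ (xs⊆ys (here refl))
... | us , vs , refl =
  ≤-trans (s≤s (unique-⊆-length u xs⊆us++vs)) (≤-reflexive (sym (length-++-sucʳ us x vs)))
  where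
  xs⊆us++vs : xs ⊆ us ++ vs
  xs⊆us++vs y∈xs with ∈-++⁻ us (xs⊆ys (there y∈xs))
  ... | inj₁ y∈us          = ∈-++⁺ˡ y∈us
  ... | inj₂ (here refl)   = ⊥-elim (All.lookup x∉xs y∈xs refl)
  ... | inj₂ (there y∈vs)  = ∈-++⁺ʳ us y∈vs

unique-⊑ : ∀ {A : Set} {xs ys : List A} → xs ⊑ ys → Unique ys → Unique xs
unique-⊑ []          []           = []
unique-⊑ (_ ∷ʳ τ)    (_ ∷ u)      = unique-⊑ τ u
unique-⊑ (refl ∷ τ)  (y∉ys ∷ u)   = All-resp-⊆ τ y∉ys ∷ unique-⊑ τ u

Edge : ℕ → Set
Edge n = Fin n × Fin n

endpoints-⊑ : ∀ {n} {M N : List (Edge n)} → M ⊑ N → endpoints M ⊑ endpoints N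
endpoints-⊑ []                = []
endpoints-⊑ ((i , j) ∷ʳ τ)   = i ∷ʳ j ∷ʳ endpoints-⊑ τ
endpoints-⊑ (refl ∷ τ)        = refl ∷ refl ∷ endpoints-⊑ τ

module SplitEdges {n ℓ} {P : Pred (Fin n) ℓ} (P? : Decidable P) where

  inside : List (Edge n) → List (Edge n)
  inside [] = []
  inside ((i , j) ∷ M) with P? i | P? j
  ... | yes _ | yes _ = (i , j) ∷ inside M
  ... | yes _ | no _  = inside M
  ... | no _  | _     = inside M

  escapees : List (Edge n) → List (Fin n)
  escapees [] = []
  escapees ((i , j) ∷ M) with P? i | P? j
  ... | yes _ | yes _ = escapees M
  ... | yes _ | no _  = j ∷ escapees M
  ... | no _  | _     = i ∷ escapees M

  inside-⊑ : ∀ M → inside M ⊑ M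
  inside-⊑ [] = []
  inside-⊑ ((i , j) ∷ M) with P? i | P? j
  ... | yes _ | yes _ = refl ∷ inside-⊑ M
  ... | yes _ | no _  = (i , j) ∷ʳ inside-⊑ M
  ... | no _  | _     = (i , j) ∷ʳ inside-⊑ M

  inside-in-P : ∀ M → All (λ e → P (proj₁ e) × P (proj₂ e)) (inside M)
  inside-in-P [] = []
  inside-in-P ((i , j) ∷ M) with P? i | P? j
  ... | yes pi | yes pj = (pi , pj) ∷ inside-in-P M
  ... | yes _  | no _   = inside-in-P M
  ... | no _   | _      = inside-in-P M

  escapees-⊑ : ∀ M → escapees M ⊑ endpoints M
  escapees-⊑ [] = []
  escapees-⊑ ((i , j) ∷ M) with P? i | P? j
  ... | yes _ | yes _ = i ∷ʳ j ∷ʳ escapees-⊑ M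
  ... | yes _ | no _  = i ∷ʳ refl ∷ escapees-⊑ M
  ... | no _  | _     = refl ∷ j ∷ʳ escapees-⊑ M

  escapees-outside-P : ∀ M → All (∁ P) (escapees M)
  escapees-outside-P [] = []
  escapees-outside-P ((i , j) ∷ M) with P? i | P? j
  ... | yes _ | yes _  = escapees-outside-P M
  ... | yes _ | no ¬pj = ¬pj ∷ escapees-outside-P M
  ... | no ¬pi | _     = ¬pi ∷ escapees-outside-P M

  length-split : ∀ M → length M ≡ length (escapees M) + length (inside M)
  length-split [] = refl
  length-split ((i , j) ∷ M) with P? i | P? j
  ... | yes _ | yes _ = trans (cong suc (length-split M))
                              (sym (+-suc (length (escapees M)) (length (inside M))))
  ... | yes _ | no _  = cong suc (length-split M)
  ... | no _  | _     = cong suc (length-split M)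

  escapees-unique : ∀ M → Unique (endpoints M) → Unique (escapees M)
  escapees-unique M = unique-⊑ (escapees-⊑ M)

Siblings : ∀ {n} → Parent n → Fin n → Fin n → Set
Siblings F i j = Is-just (F i) × F i ≡ F j

Separated : ∀ {n} → Parent n → Fin n → Fin n → Set
Separated F₂ i j = Is-just (F₂ i) × Is-just (F₂ j) × F₂ i ≢ F₂ j

Migration : ∀ {n} → Parent n → Parent n → Edge n → Set
Migration F F₂ (i , j) = Siblings F i j × Separated F₂ i j

MigrationMatching : ∀ {n} → Parent n → Parent n → List (Edge n) → Set
MigrationMatching F F₂ M = Unique (endpoints M) × All (Migration F F₂) M

matching⇒migrationMatching : ∀ {n} {F₁ F₂ : Parent n} {M} →
  IsMatching F₁ F₂ M → MigrationMatching F₁ F₂ M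
matching⇒migrationMatching (edges , u) =
  u , All.map (λ (j₁ , _ , j₂ , j₂′ , eq , ne) → (j₁ , eq) , (j₂ , j₂′ , ne)) edges

is-just≢nothing : ∀ {A : Set} {m : Maybe A} → Is-just m → m ≢ nothing
is-just≢nothing (MaybeAny.just _) ()

is-just-map : ∀ {A B : Set} (f : A → B) {m : Maybe A} → Is-just m → Is-just (Maybe.map f m)
is-just-map f (MaybeAny.just t) = MaybeAny.just t

∼-agree : ∀ {n} {G F₂ : Parent n} → G ∼ F₂ → ∀ x → Is-just (G x) → Is-just (F₂ x) → G x ≡ F₂ x
∼-agree G∼F₂ x jG jF₂ with G∼F₂ x
... | inj₁ eq           = eq
... | inj₂ (inj₁ none)  = ⊥-elim (is-just≢nothing jG none)
... | inj₂ (inj₂ none)  = ⊥-elim (is-just≢nothing jF₂ none)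

no-migration : ∀ {n} {G F₂ : Parent n} → G ∼ F₂ → ∀ e → ¬ Migration G F₂ e
no-migration G∼F₂ (i , j) ((jGi , Gi≡Gj) , (jF₂i , jF₂j , F₂i≢F₂j)) =
  F₂i≢F₂j (trans (sym (∼-agree G∼F₂ i jGi jF₂i))
           (trans Gi≡Gj (∼-agree G∼F₂ j (subst Is-just Gi≡Gj jGi) jF₂j)))

cutOp-elsewhere : ∀ {n} (F : Parent n) (v x : Fin n) → x ≢ v → cutOp F v x ≡ F x
cutOp-elsewhere F v x x≢v with x ≟ v
... | yes x≡v = ⊥-elim (x≢v x≡v)
... | no _    = refl

permOp-at-fixed : ∀ {n} (π : Permutation′ n) (F : Parent n) (x : Fin n) → π ⟨$⟩ʳ x ≡ x →
  permOp π F x ≡ Maybe.map (π ⟨$⟩ʳ_) (F x)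
permOp-at-fixed π F x πx≡x = cong (λ y → Maybe.map (π ⟨$⟩ʳ_) (F y)) π⁻¹x≡x
  where
  π⁻¹x≡x : π ⟨$⟩ˡ x ≡ x
  π⁻¹x≡x = trans (cong (π ⟨$⟩ˡ_) (sym πx≡x)) (inverseˡ π)

cut-keeps-siblings : ∀ {n} (F : Parent n) (v : Fin n) {i j} →
  i ≢ v → j ≢ v → Siblings F i j → Siblings (cutOp F v) i j
cut-keeps-siblings F v {i} {j} i≢v j≢v sib
  rewrite cutOp-elsewhere F v i i≢v | cutOp-elsewhere F v j j≢v = sib

perm-keeps-siblings : ∀ {n} (π : Permutation′ n) (F : Parent n) {i j} →
  π ⟨$⟩ʳ i ≡ i → π ⟨$⟩ʳ j ≡ j → Siblings F i j → Siblings (permOp π F) i j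
perm-keeps-siblings π F {i} {j} πi≡i πj≡j (jFi , Fi≡Fj)
  rewrite permOp-at-fixed π F i πi≡i | permOp-at-fixed π F j πj≡j =
  is-just-map (π ⟨$⟩ʳ_) jFi , cong (Maybe.map (π ⟨$⟩ʳ_)) Fi≡Fj

module Step {n ℓ} {P : Pred (Fin n) ℓ} (P? : Decidable P) {F F′ F₂ : Parent n}
  (keeps : ∀ {i j} → P i → P j → Siblings F i j → Siblings F′ i j) where
  open SplitEdges P? public

  restrict : ∀ {M} → MigrationMatching F F₂ M → MigrationMatching F′ F₂ (inside M)
  restrict {M} (u , migs) =
    unique-⊑ (endpoints-⊑ (inside-⊑ M)) u ,
    All.zipWith (λ ((pi , pj) , (sib , sep)) → keeps pi pj sib , sep)
                (inside-in-P M , All-resp-⊆ (inside-⊑ M) migs)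

  step : ∀ {k} → (∀ M′ → MigrationMatching F′ F₂ M′ → length M′ ≤ k) →
    ∀ M → MigrationMatching F F₂ M → length M ≤ length (escapees M) + k
  step bound′ M mm = ≤-trans (≤-reflexive (length-split M))
                             (+-mono-≤ ≤-refl (bound′ (inside M) (restrict mm)))

migration-bound : ∀ {n} {F G F₂ : Parent n} {k} → Seq F G k → G ∼ F₂ →
  ∀ M → MigrationMatching F F₂ M → length M ≤ k
migration-bound done G∼F₂ []      _ = z≤n
migration-bound done G∼F₂ (e ∷ _) (_ , mig ∷ _) = ⊥-elim (no-migration G∼F₂ e mig)
migration-bound {F = F} {F₂ = F₂} (cut {k = k} v _ _ sq) G∼F₂ M mm@(u , _) = begin
  length M                     ≤⟨ step (migration-bound sq G∼F₂) M mm ⟩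
  length (escapees M) + k      ≤⟨ +-mono-≤ at-most-one ≤-refl ⟩
  1 + k                        ∎
  where
  open ≤-Reasoning
  open Step (λ x → ¬? (x ≟ v)) {F₂ = F₂} (cut-keeps-siblings F v)
  -- the only possible escapee is v itself
  at-most-one : length (escapees M) ≤ 1
  at-most-one = unique-⊆-length {ys = [ v ]} (escapees-unique M u)
    (λ {x} x∈ → here (decidable-stable (x ≟ v) (All.lookup (escapees-outside-P M) x∈)))
migration-bound {F = F} {F₂ = F₂} (perm {k = k} π sq) G∼F₂ M mm@(u , _) = begin
  length M                     ≤⟨ step (migration-bound sq G∼F₂) M mm ⟩
  length (escapees M) + k      ≤⟨ +-mono-≤ at-most-moved ≤-refl ⟩
  moved π + k                  ∎
  where
  open ≤-Reasoning
  open Step (λ x → (π ⟨$⟩ʳ x) ≟ x) {F₂ = F₂} (perm-keeps-siblings π F)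
  -- the escapees are distinct points moved by π
  at-most-moved : length (escapees M) ≤ moved π
  at-most-moved = unique-⊆-length (escapees-unique M u)
    (λ {x} x∈ → ∈-filter⁺ (λ y → ¬? ((π ⟨$⟩ʳ y) ≟ y)) (∈-allFin x)
                          (All.lookup (escapees-outside-P M) x∈))

lemma15 : ∀ (n : ℕ) (F₁ F₂ : Parent n) → Forest F₁ → Forest F₂ →
    (M : List (Fin n × Fin n)) → IsMatching F₁ F₂ M →
    ∀ (F₁′ : Parent n) (k : ℕ) → Seq F₁ F₁′ k → F₁′ ∼ F₂ → length M ≤ k
lemma15 n F₁ F₂ _ _ M isMatching F₁′ k sq F₁′∼F₂ =
  migration-bound sq F₁′∼F₂ M (matching⇒migrationMatching isMatching)
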